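{- Let $\mathbf f=010010100100101\cdots$ be the Fibonacci word (the fixed point of $0\mapsto01$, $1\mapsto0$). Then for every prefix $u$ of $\mathbf f$ the set $\mathbf f\big|_u$ is an IP$^*$-set (and hence a central$^*$ set). Setting $\mathbf g=0\mathbf f$, for every prefix $u$ of $\mathbf f$ the sets $\mathbf g\big|_{0u}$ and $\mathbf g\big|_{1u}$ are both IP-sets (equivalently, central sets).
   Context: $\mathbb N=\{0,1,2,\dots\}$; for an infinite word $w$ and finite word $v$, $w\big|_v=\{n\in\mathbb N: w_n\cdots w_{n+|v|-1}=v\}$. A set $A\subseteq\mathbb N$ is an IP-set if there is $x_0<x_1<\cdots$ in $\mathbb N$ with all finite sums $\sum_{n\in F}x_n$ ($F$ non-empty finite) in $A$; an IP$^*$-set meets every IP-set. With $\beta\mathbb N$ the ultrafilters on $\mathbb N$ and $p+q=\{A:\{n:A-n\in p\}\in q\}$ ($A-n=\{m:m+n\in A\}$), $A$ is central if it belongs to some non-principal $p=p+p$ in the smallest two-sided ideal of $\beta\mathbb N$, and central$^*$ if it meets every central set. -}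

module Defs where

open import Data.Nat using (ℕ; zero; suc; _+_; _<_)
open import Data.List using (List; []; _∷_; _++_; map; upTo; concatMap)
open import Data.Nat.ListAction using (sum)
open import Data.List.Relation.Unary.Unique.Propositional using (Unique)
open import Data.List.Membership.Propositional using (_∈_)
open import Data.Product using (Σ; _×_; _,_)
open import Data.Unit using (⊤)
open import Relation.Binary.PropositionalEquality using (_≡_; _≢_)

Word : Set
Word = ℕ → ℕ

-- the Fibonacci morphism 0 ↦ 01, 1 ↦ 0 (other letters ↦ 0, irrelevant)
φ₁ : ℕ → List ℕ
φ₁ zero = 0 ∷ 1 ∷ []
φ₁ (suc _) = 0 ∷ []

φ : List ℕ → List ℕ
φ = concatMap φ₁

φ^ : ℕ → List ℕ
φ^ zero = 0 ∷ []
φ^ (suc n) = φ (φ^ n)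

-- n-th letter of a list (default 0 when out of range; never used, since
-- |φ^(k+1)(0)| ≥ k+1 and φ^n(0) is a prefix of φ^(n+1)(0))
nth : List ℕ → ℕ → ℕ
nth [] _ = 0
nth (a ∷ _) zero = a
nth (_ ∷ l) (suc k) = nth l k

-- the Fibonacci word f = lim φ^n(0) = 010010100100101…
fib : Word
fib k = nth (φ^ (suc k)) k

gword : Word
gword zero = 0
gword (suc n) = fib n

prefix : Word → ℕ → List ℕ
prefix w k = map w (upTo k)

-- Occ w v n  ⇔  n ∈ w|_v, i.e. w_n ⋯ w_{n+|v|-1} = v
Occ : Word → List ℕ → ℕ → Set
Occ w [] n = ⊤
Occ w (a ∷ v) n = (w n ≡ a) × Occ w v (suc n)

-- IP-set: there are x₀ < x₁ < ⋯ with all sums over non-empty finite index sets in A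
-- (a non-empty finite F ⊆ ℕ is given as a non-empty duplicate-free list)
IPSet : (ℕ → Set) → Set
IPSet A = Σ (ℕ → ℕ) λ x →
  ((m : ℕ) → x m < x (suc m)) ×
  ((F : List ℕ) → F ≢ [] → Unique F → A (sum (map x F)))

IPStarSet : (ℕ → Set) → Set₁
IPStarSet A = (B : ℕ → Set) → IPSet B → Σ ℕ λ n → A n × B n

-- Write β = ϕ⁻¹ = ϕ - 1 and compute exactly in ℤ[ϕ], whose order is decided by a
-- Euclid-like algorithm. The Fibonacci word is the Sturmian coding of the rotation
-- n ↦ nβ mod 1: letter n is 1 iff (n+1)β mod 1 < β². The first k rotation points
-- all keep some distance δ > 0 from the cut points 0 and β², so the prefix of length
-- k occurs at every position d with dβ mod 1 within δ of 0.
-- IP*: for generators x₀ < x₁ < ⋯, by pigeonhole two of the points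
-- (x₀ + ⋯ + xₙ₋₁)β mod 1 are closer than δ, and the difference of their indices is
-- a finite sum of the xᵢ.
-- IP: the Fibonacci numbers F with index m + 2i + 1 satisfy Fβ ≡ ±ϕ⁻⁽ᵐ⁺²ⁱ⁺¹⁾ mod 1,
-- and a sum of such distinct terms lies in (0, ϕ⁻ᵐ). So for large m the finite sums
-- d of these numbers have dβ mod 1 just above 0 (m even) or just below 1 (m odd);
-- this also fixes the letter before the occurrence in 0f to be 1, resp. 0.

module Submission where

open import Defs
open import Data.Nat as ℕ using (ℕ; zero; suc; z≤n; s≤s; less; equal; greater; compare)
import Data.Nat.Properties as ℕP
import Data.Nat.Tactic.RingSolver as ℕS
open import Data.Integer as ℤ using (ℤ; +_; -[1+_]; +[1+_]; _⊖_)
import Data.Integer.Properties as ℤP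
open import Data.Integer.Tactic.RingSolver using (solve; solve-∀)
open import Data.List using (List; []; _∷_; _++_; _∷ʳ_; [_]; applyUpTo; map; iterate)
open import Data.Nat.ListAction using (sum)
open import Data.List.Relation.Unary.All as All using (All)
open import Data.List.Relation.Unary.Unique.Propositional using (Unique)
import Data.List.Relation.Unary.AllPairs as AllPairs
import Data.List.Relation.Unary.All.Properties as AllP
open import Data.List.Relation.Unary.Any using (here; there)
open import Data.List.Relation.Binary.Subset.Propositional using (_⊆_)
import Data.List.Properties as LP
open import Data.Product using (∃-syntax; ∃₂; _×_; _,_; proj₁; proj₂)
open import Data.Sum as Sum using (_⊎_; inj₁; inj₂; map₂)
open import Data.Empty using (⊥-elim)
open import Data.Unit using (tt)
open import Function using (_∘_)
open import Data.Fin as Fin using (Fin; toℕ; fromℕ<)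
import Data.Fin.Properties as FinP
open import Relation.Nullary using (¬_; yes; no)
open import Relation.Binary.PropositionalEquality hiding ([_])
open import Induction.WellFounded using (Acc; acc)
open import Data.Nat.Induction using (<-wellFounded)
open import Level using (0ℓ)
open import Relation.Binary using (Trichotomous; tri<; tri≈; tri>; StrictPartialOrder; Decidable)
open import Relation.Binary.Consequences using (tri⇒dec<)
import Relation.Binary.Reasoning.StrictPartialOrder

-- The ring ℤ[ϕ]

-- mk a b stands for a + bϕ, where ϕ = (1 + √5)/2. Without η, matching on mk makes
-- the operations below compute on coefficients, so that identities in ℤ[ϕ]
-- reduce to identities in ℤ for the ring solver.
record ℤ[ϕ] : Set where
  no-eta-equality
  pattern
  constructor mk
  field
    c₀ c₁ : ℤ
open ℤ[ϕ]

infixl 6 _⊕_ _⊝_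
infix 8 ⊖_

_⊕_ : ℤ[ϕ] → ℤ[ϕ] → ℤ[ϕ]
mk a b ⊕ mk c d = mk (a ℤ.+ c) (b ℤ.+ d)

⊖_ : ℤ[ϕ] → ℤ[ϕ]
⊖ mk a b = mk (ℤ.- a) (ℤ.- b)

_⊝_ : ℤ[ϕ] → ℤ[ϕ] → ℤ[ϕ]
x ⊝ y = x ⊕ ⊖ y

𝟘 𝟙 : ℤ[ϕ]
𝟘 = mk (+ 0) (+ 0)
𝟙 = mk (+ 1) (+ 0)

ϕ·_ ϕ⁻¹·_ : ℤ[ϕ] → ℤ[ϕ]
ϕ· mk a b = mk b (a ℤ.+ b)
ϕ⁻¹· mk a b = mk (b ℤ.- a) a

ϕ^_·_ : ℕ → ℤ[ϕ] → ℤ[ϕ]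
ϕ^ zero · x = x
ϕ^ suc k · x = ϕ^ k · (ϕ· x)

ϕ⁻^_·_ : ℕ → ℤ[ϕ] → ℤ[ϕ]
ϕ⁻^ zero · x = x
ϕ⁻^ suc k · x = ϕ⁻¹· (ϕ⁻^ k · x)

ϕ⁻^_ : ℕ → ℤ[ϕ]
ϕ⁻^ k = ϕ⁻^ k · 𝟙

⊕-identityˡ : ∀ x → 𝟘 ⊕ x ≡ x
⊕-identityˡ (mk a b) = cong₂ mk (ℤP.+-identityˡ a) (ℤP.+-identityˡ b)

⊕-identityʳ : ∀ x → x ⊕ 𝟘 ≡ x
⊕-identityʳ (mk a b) = cong₂ mk (ℤP.+-identityʳ a) (ℤP.+-identityʳ b)

⊝-identityʳ : ∀ x → x ⊝ 𝟘 ≡ x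
⊝-identityʳ (mk a b) = cong₂ mk (ℤP.+-identityʳ a) (ℤP.+-identityʳ b)

⊝-⊕-cancel : ∀ x y → (y ⊝ x) ⊕ x ≡ y
⊝-⊕-cancel (mk a b) (mk c d) = cong₂ mk (solve (a ∷ c ∷ [])) (solve (b ∷ d ∷ []))

⊝-self : ∀ x → x ⊝ x ≡ 𝟘
⊝-self (mk a b) = cong₂ mk (ℤP.+-inverseʳ a) (ℤP.+-inverseʳ b)

⊝-split : ∀ x y z → z ⊝ x ≡ (z ⊝ y) ⊕ (y ⊝ x)
⊝-split (mk a b) (mk c d) (mk e f) = cong₂ mk (solve (a ∷ c ∷ e ∷ [])) (solve (b ∷ d ∷ f ∷ []))

⊖-⊝ : ∀ x y → ⊖ (y ⊝ x) ≡ x ⊝ y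
⊖-⊝ (mk a b) (mk c d) = cong₂ mk (solve (a ∷ c ∷ [])) (solve (b ∷ d ∷ []))

⊕-⊝-⊕ʳ : ∀ x y z → (y ⊕ z) ⊝ (x ⊕ z) ≡ y ⊝ x
⊕-⊝-⊕ʳ (mk a b) (mk c d) (mk e f) = cong₂ mk (solve (a ∷ c ∷ e ∷ [])) (solve (b ∷ d ∷ f ∷ []))

⊕-⊝-⊕ˡ : ∀ x y z → (z ⊕ y) ⊝ (z ⊕ x) ≡ y ⊝ x
⊕-⊝-⊕ˡ (mk a b) (mk c d) (mk e f) = cong₂ mk (solve (a ∷ c ∷ e ∷ [])) (solve (b ∷ d ∷ f ∷ []))

⊕-comm : ∀ x y → x ⊕ y ≡ y ⊕ x
⊕-comm (mk a b) (mk c d) = cong₂ mk (ℤP.+-comm a c) (ℤP.+-comm b d)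

⊕-assoc : ∀ x y z → (x ⊕ y) ⊕ z ≡ x ⊕ (y ⊕ z)
⊕-assoc (mk a b) (mk c d) (mk e f) = cong₂ mk (ℤP.+-assoc a c e) (ℤP.+-assoc b d f)

⊕-swap : ∀ x y z → x ⊕ (y ⊕ z) ≡ y ⊕ (x ⊕ z)
⊕-swap (mk a b) (mk c d) (mk e f) = cong₂ mk (solve (a ∷ c ∷ e ∷ [])) (solve (b ∷ d ∷ f ∷ []))

c₁-⊕ : ∀ x y → c₁ (x ⊕ y) ≡ c₁ x ℤ.+ c₁ y
c₁-⊕ (mk _ _) (mk _ _) = refl

c₁-⊝𝟙 : ∀ x → c₁ (x ⊝ 𝟙) ≡ c₁ x
c₁-⊝𝟙 (mk a b) = ℤP.+-identityʳ b

c₁-𝟙⊝ : ∀ x → c₁ (𝟙 ⊝ x) ≡ ℤ.- c₁ x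
c₁-𝟙⊝ (mk a b) = ℤP.+-identityˡ (ℤ.- b)

ϕ·-⊕ : ∀ x y → ϕ· (x ⊕ y) ≡ ϕ· x ⊕ ϕ· y
ϕ·-⊕ (mk a b) (mk c d) = cong (mk _) (solve (a ∷ b ∷ c ∷ d ∷ []))

ϕ·-⊖ : ∀ x → ϕ· (⊖ x) ≡ ⊖ ϕ· x
ϕ·-⊖ (mk a b) = cong (mk _) (solve (a ∷ b ∷ []))

ϕ·-ϕ⁻¹· : ∀ x → ϕ· (ϕ⁻¹· x) ≡ x
ϕ·-ϕ⁻¹· (mk a b) = cong₂ mk refl (solve (a ∷ b ∷ []))

ϕ^-+ : ∀ k j x → ϕ^ (k ℕ.+ j) · x ≡ ϕ^ j · (ϕ^ k · x)
ϕ^-+ zero j x = refl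
ϕ^-+ (suc k) j x = ϕ^-+ k j (ϕ· x)

ϕ^-⊕ : ∀ k x y → ϕ^ k · (x ⊕ y) ≡ ϕ^ k · x ⊕ ϕ^ k · y
ϕ^-⊕ zero x y = refl
ϕ^-⊕ (suc k) x y = trans (cong (ϕ^ k ·_) (ϕ·-⊕ x y)) (ϕ^-⊕ k (ϕ· x) (ϕ· y))

ϕ^-⊖ : ∀ k x → ϕ^ k · (⊖ x) ≡ ⊖ ϕ^ k · x
ϕ^-⊖ zero x = refl
ϕ^-⊖ (suc k) x = trans (cong (ϕ^ k ·_) (ϕ·-⊖ x)) (ϕ^-⊖ k (ϕ· x))

ϕ^-⊝ : ∀ k x y → ϕ^ k · (x ⊝ y) ≡ ϕ^ k · x ⊝ ϕ^ k · y
ϕ^-⊝ k x y = trans (ϕ^-⊕ k x (⊖ y)) (cong (ϕ^ k · x ⊕_) (ϕ^-⊖ k y))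

ϕ^-𝟘 : ∀ k → ϕ^ k · 𝟘 ≡ 𝟘
ϕ^-𝟘 zero = refl
ϕ^-𝟘 (suc k) = ϕ^-𝟘 k

ϕ⁻¹·-⊝ : ∀ x y → ϕ⁻¹· (x ⊝ y) ≡ ϕ⁻¹· x ⊝ ϕ⁻¹· y
ϕ⁻¹·-⊝ (mk a b) (mk c d) = cong₂ mk (solve (a ∷ b ∷ c ∷ d ∷ [])) refl

ϕ^-ϕ⁻^ : ∀ k x → ϕ^ k · (ϕ⁻^ k · x) ≡ x
ϕ^-ϕ⁻^ zero x = refl
ϕ^-ϕ⁻^ (suc k) x = trans (cong (ϕ^ k ·_) (ϕ·-ϕ⁻¹· (ϕ⁻^ k · x))) (ϕ^-ϕ⁻^ k x)

ϕ⁻^-comm : ∀ k x → ϕ⁻^ k · (ϕ⁻¹· x) ≡ ϕ⁻¹· (ϕ⁻^ k · x)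
ϕ⁻^-comm zero x = refl
ϕ⁻^-comm (suc k) x = cong ϕ⁻¹·_ (ϕ⁻^-comm k x)

ι : ℤ → ℤ[ϕ]
ι n = mk n (+ 0)

-- Positivity

data PositiveCoeffs : ℤ[ϕ] → Set where
  positiveCoeffs : ∀ {a b} → + 0 ℤ.≤ a → + 0 ℤ.< b → PositiveCoeffs (mk a b)

-- Since ϕ is a Pisot number, multiplying by ϕ makes the coefficients of a
-- positive element eventually positive; we take this as the definition.
Positive : ℤ[ϕ] → Set
Positive x = ∃[ k ] PositiveCoeffs (ϕ^ k · x)

PositiveCoeffs-ϕ· : ∀ {x} → PositiveCoeffs x → PositiveCoeffs (ϕ· x)
PositiveCoeffs-ϕ· (positiveCoeffs 0≤a 0<b) = positiveCoeffs (ℤP.<⇒≤ 0<b) (ℤP.+-mono-≤-< 0≤a 0<b)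

PositiveCoeffs-ϕ^ : ∀ j {x} → PositiveCoeffs x → PositiveCoeffs (ϕ^ j · x)
PositiveCoeffs-ϕ^ zero p = p
PositiveCoeffs-ϕ^ (suc j) p = PositiveCoeffs-ϕ^ j (PositiveCoeffs-ϕ· p)

PositiveCoeffs-⊕ : ∀ {x y} → PositiveCoeffs x → PositiveCoeffs y → PositiveCoeffs (x ⊕ y)
PositiveCoeffs-⊕ (positiveCoeffs p q) (positiveCoeffs r s) = positiveCoeffs (ℤP.+-mono-≤ p r) (ℤP.+-mono-<-≤ q (ℤP.<⇒≤ s))

PositiveCoeffs-⊖ : ∀ {x} → PositiveCoeffs x → ¬ PositiveCoeffs (⊖ x)
PositiveCoeffs-⊖ {mk a b} (positiveCoeffs _ 0<b) (positiveCoeffs _ 0<-b) = ℤP.<-asym 0<b (ℤP.neg-cancel-< {+ 0} {b} 0<-b)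

PositiveCoeffs-after : ∀ {x} (p : Positive x) j → PositiveCoeffs (ϕ^ (proj₁ p ℕ.+ j) · x)
PositiveCoeffs-after {x} (k , c) j = subst PositiveCoeffs (sym (ϕ^-+ k j x)) (PositiveCoeffs-ϕ^ j c)

PositiveCoeffs-after′ : ∀ {x} (p : Positive x) j → PositiveCoeffs (ϕ^ (j ℕ.+ proj₁ p) · x)
PositiveCoeffs-after′ {x} p j = subst (λ n → PositiveCoeffs (ϕ^ n · x)) (ℕP.+-comm (proj₁ p) j) (PositiveCoeffs-after p j)

Positive-⊕ : ∀ {x y} → Positive x → Positive y → Positive (x ⊕ y)
Positive-⊕ {x} {y} p q = proj₁ p ℕ.+ proj₁ q ,
  subst PositiveCoeffs (sym (ϕ^-⊕ (proj₁ p ℕ.+ proj₁ q) x y)) (PositiveCoeffs-⊕ (PositiveCoeffs-after p (proj₁ q)) (PositiveCoeffs-after′ q (proj₁ p)))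

Positive-asym : ∀ {x} → Positive x → ¬ Positive (⊖ x)
Positive-asym {x} p q = PositiveCoeffs-⊖ (PositiveCoeffs-after p (proj₁ q))
  (subst PositiveCoeffs (ϕ^-⊖ (proj₁ p ℕ.+ proj₁ q) x) (PositiveCoeffs-after′ q (proj₁ p)))

ϕ^-reflects-Positive : ∀ k {x} → Positive (ϕ^ k · x) → Positive x
ϕ^-reflects-Positive k {x} (j , c) = k ℕ.+ j , subst PositiveCoeffs (sym (ϕ^-+ k j x)) c

Positive-ϕ⁻¹· : ∀ {x} → Positive x → Positive (ϕ⁻¹· x)
Positive-ϕ⁻¹· {x} (k , c) = suc k , subst (λ y → PositiveCoeffs (ϕ^ k · y)) (sym (ϕ·-ϕ⁻¹· x)) c

Sign : ℤ[ϕ] → Set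
Sign x = Positive x ⊎ Positive (⊖ x)

ϕ·-reflects-Sign : ∀ {x} → Sign (ϕ· x) → Sign x
ϕ·-reflects-Sign (inj₁ (k , c)) = inj₁ (suc k , c)
ϕ·-reflects-Sign {x} (inj₂ (k , c)) = inj₂ (suc k , subst (λ y → PositiveCoeffs (ϕ^ k · y)) (sym (ϕ·-⊖ x)) c)

1+m+n⊖m : ∀ m n → suc (m ℕ.+ n) ⊖ m ≡ +[1+ n ]
1+m+n⊖m zero n = refl
1+m+n⊖m (suc m) n = trans (ℤP.[1+m]⊖[1+n]≡m⊖n (suc (m ℕ.+ n)) m) (1+m+n⊖m m n)

m⊖1+m+n : ∀ m n → m ⊖ suc (m ℕ.+ n) ≡ -[1+ n ]
m⊖1+m+n zero n = refl
m⊖1+m+n (suc m) n = trans (ℤP.[1+m]⊖[1+n]≡m⊖n m (suc (m ℕ.+ n))) (m⊖1+m+n m n)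

0≤+ : ∀ {n} → + 0 ℤ.≤ + n
0≤+ = ℤ.+≤+ z≤n

0<+[1+] : ∀ {n} → + 0 ℤ.< +[1+ n ]
0<+[1+] = ℤ.+<+ (s≤s z≤n)

-- ϕ·(a + bϕ) = b + (a + b)ϕ: when a and b have opposite signs this is a step of
-- Euclid's algorithm, so the coefficients eventually agree in sign.
sign-mixed⁺ : ∀ p q → Acc ℕ._<_ p → Sign (mk -[1+ p ] +[1+ q ])
sign-mixed⁻ : ∀ p q → Acc ℕ._<_ p → Sign (mk +[1+ p ] -[1+ q ])

sign-ϕ·mixed⁺ : ∀ q p → Acc ℕ._<_ p → Sign (mk +[1+ q ] (q ⊖ p))
sign-ϕ·mixed⁺ q p rec with compare q p
sign-ϕ·mixed⁺ q _ (acc rs) | less .q k rewrite m⊖1+m+n q k = sign-mixed⁻ q k (rs (s≤s (ℕP.m≤m+n q k)))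
sign-ϕ·mixed⁺ q _ _ | equal .q rewrite ℤP.n⊖n≡0 q = inj₁ (1 , positiveCoeffs 0≤+ 0<+[1+])
sign-ϕ·mixed⁺ _ p _ | greater .p k rewrite 1+m+n⊖m p k = inj₁ (0 , positiveCoeffs 0≤+ 0<+[1+])

sign-ϕ·mixed⁻ : ∀ p q → Acc ℕ._<_ p → Sign (mk -[1+ q ] (p ⊖ q))
sign-ϕ·mixed⁻ p q rec with compare p q
sign-ϕ·mixed⁻ p _ _ | less .p k rewrite m⊖1+m+n p k = inj₂ (0 , positiveCoeffs 0≤+ 0<+[1+])
sign-ϕ·mixed⁻ p _ _ | equal .p rewrite ℤP.n⊖n≡0 p = inj₂ (1 , positiveCoeffs 0≤+ 0<+[1+])
sign-ϕ·mixed⁻ _ q (acc rs) | greater .q k rewrite 1+m+n⊖m q k = sign-mixed⁺ q k (rs (s≤s (ℕP.m≤m+n q k)))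

sign-mixed⁺ p q rec = ϕ·-reflects-Sign (subst (λ c → Sign (mk +[1+ q ] c)) (sym (ℤP.[1+m]⊖[1+n]≡m⊖n q p)) (sign-ϕ·mixed⁺ q p rec))
sign-mixed⁻ p q rec = ϕ·-reflects-Sign (subst (λ c → Sign (mk -[1+ q ] c)) (sym (ℤP.[1+m]⊖[1+n]≡m⊖n p q)) (sign-ϕ·mixed⁻ p q rec))

Positive-trichotomy : ∀ x → Positive x ⊎ x ≡ 𝟘 ⊎ Positive (⊖ x)
Positive-trichotomy (mk (+ m) +[1+ n ]) = inj₁ (0 , positiveCoeffs 0≤+ 0<+[1+])
Positive-trichotomy (mk +[1+ m ] (+ 0)) = inj₁ (1 , positiveCoeffs 0≤+ 0<+[1+])
Positive-trichotomy (mk (+ 0) (+ 0)) = inj₂ (inj₁ refl)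
Positive-trichotomy (mk -[1+ m ] -[1+ n ]) = inj₂ (inj₂ (0 , positiveCoeffs 0≤+ 0<+[1+]))
Positive-trichotomy (mk -[1+ m ] (+ 0)) = inj₂ (inj₂ (1 , positiveCoeffs 0≤+ 0<+[1+]))
Positive-trichotomy (mk (+ 0) -[1+ n ]) = inj₂ (inj₂ (0 , positiveCoeffs 0≤+ 0<+[1+]))
Positive-trichotomy (mk +[1+ m ] -[1+ n ]) = map₂ inj₂ (sign-mixed⁻ m n (<-wellFounded m))
Positive-trichotomy (mk -[1+ m ] +[1+ n ]) = map₂ inj₂ (sign-mixed⁺ m n (<-wellFounded m))

-- The order

infix 4 _<_ _≤_ _<?_

record _<_ (x y : ℤ[ϕ]) : Set where
  constructor fromPositive
  field
    toPositive : Positive (y ⊝ x)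
open _<_

<-respᵈ : ∀ {x y x′ y′} → y ⊝ x ≡ y′ ⊝ x′ → x < y → x′ < y′
<-respᵈ e (fromPositive p) = fromPositive (subst Positive e p)

_≤_ : ℤ[ϕ] → ℤ[ϕ] → Set
x ≤ y = x < y ⊎ x ≡ y

<-trans : ∀ {x y z} → x < y → y < z → x < z
<-trans {x} {y} {z} (fromPositive p) (fromPositive q) = fromPositive (subst Positive (sym (⊝-split x y z)) (Positive-⊕ q p))

<-asym : ∀ {x y} → x < y → ¬ y < x
<-asym {x} {y} (fromPositive p) (fromPositive q) = Positive-asym p (subst Positive (sym (⊖-⊝ x y)) q)

<-irrefl : ∀ {x} → ¬ x < x
<-irrefl x<x = <-asym x<x x<x

0<⇒Positive : ∀ {x} → 𝟘 < x → Positive x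
0<⇒Positive {x} (fromPositive p) = subst Positive (⊝-identityʳ x) p

Positive⇒0< : ∀ {x} → Positive x → 𝟘 < x
Positive⇒0< {x} p = fromPositive (subst Positive (sym (⊝-identityʳ x)) p)

⊝≡𝟘⇒≡ : ∀ {x y} → y ⊝ x ≡ 𝟘 → x ≡ y
⊝≡𝟘⇒≡ {x} {y} y⊝x≡𝟘 = trans (sym (⊕-identityˡ x)) (trans (cong (_⊕ x) (sym y⊝x≡𝟘)) (⊝-⊕-cancel x y))

<-cmp : Trichotomous _≡_ _<_
<-cmp x y with Positive-trichotomy (y ⊝ x)
... | inj₁ p = tri< x<y (λ { refl → <-irrefl x<y }) (<-asym x<y)
  where
  x<y : x < y
  x<y = fromPositive p
... | inj₂ (inj₁ y⊝x≡𝟘) with refl ← ⊝≡𝟘⇒≡ {x} {y} y⊝x≡𝟘 = tri≈ <-irrefl refl <-irrefl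
... | inj₂ (inj₂ y<x) = tri> (<-asym y<x′) (λ { refl → <-irrefl y<x′ }) y<x′
  where
  y<x′ : y < x
  y<x′ = fromPositive (subst Positive (⊖-⊝ x y) y<x)

<-strictPartialOrder : StrictPartialOrder 0ℓ 0ℓ 0ℓ
<-strictPartialOrder = record
  { Carrier = ℤ[ϕ]
  ; _≈_ = _≡_
  ; _<_ = _<_
  ; isStrictPartialOrder = record
    { isEquivalence = isEquivalence
    ; irrefl = λ { refl → <-irrefl }
    ; trans = λ {x} {y} {z} → <-trans {x} {y} {z}
    ; <-resp-≈ = (λ { refl p → p }) , (λ { refl p → p })
    }
  }

module ≤-Reasoning = Relation.Binary.Reasoning.StrictPartialOrder <-strictPartialOrder

_<?_ : Decidable _<_
_<?_ = tri⇒dec< <-cmp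

<⇒≤ : ∀ {x y} → x < y → x ≤ y
<⇒≤ = inj₁

≤-refl : ∀ {x} → x ≤ x
≤-refl = inj₂ refl

≮⇒≥ : ∀ {x y} → ¬ x < y → y ≤ x
≮⇒≥ {x} {y} x≮y with <-cmp x y
... | tri< x<y _ _ = ⊥-elim (x≮y x<y)
... | tri≈ _ refl _ = ≤-refl
... | tri> _ _ y<x = <⇒≤ y<x

≤⇒≯ : ∀ {x y} → x ≤ y → ¬ y < x
≤⇒≯ (inj₁ x<y) = <-asym x<y
≤⇒≯ (inj₂ refl) = <-irrefl

<-≤-trans : ∀ {x y z} → x < y → y ≤ z → x < z
<-≤-trans x<y (inj₁ y<z) = <-trans x<y y<z
<-≤-trans x<y (inj₂ refl) = x<y

≤-<-trans : ∀ {x y z} → x ≤ y → y < z → x < z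
≤-<-trans (inj₁ x<y) y<z = <-trans x<y y<z
≤-<-trans (inj₂ refl) y<z = y<z

≤-trans : ∀ {x y z} → x ≤ y → y ≤ z → x ≤ z
≤-trans (inj₁ x<y) y≤z = <⇒≤ (<-≤-trans x<y y≤z)
≤-trans (inj₂ refl) y≤z = y≤z

⊕-monoˡ-< : ∀ z {x y} → x < y → x ⊕ z < y ⊕ z
⊕-monoˡ-< z {x} {y} = <-respᵈ (sym (⊕-⊝-⊕ʳ x y z))

⊕-monoʳ-< : ∀ z {x y} → x < y → z ⊕ x < z ⊕ y
⊕-monoʳ-< z {x} {y} = <-respᵈ (sym (⊕-⊝-⊕ˡ x y z))

⊕-monoˡ-≤ : ∀ z {x y} → x ≤ y → x ⊕ z ≤ y ⊕ z
⊕-monoˡ-≤ z (inj₁ x<y) = <⇒≤ (⊕-monoˡ-< z x<y)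
⊕-monoˡ-≤ z (inj₂ refl) = ≤-refl

⊕-monoʳ-≤ : ∀ z {x y} → x ≤ y → z ⊕ x ≤ z ⊕ y
⊕-monoʳ-≤ z (inj₁ x<y) = <⇒≤ (⊕-monoʳ-< z x<y)
⊕-monoʳ-≤ z (inj₂ refl) = ≤-refl

⊕-mono-<-≤ : ∀ {x y u v} → x < y → u ≤ v → x ⊕ u < y ⊕ v
⊕-mono-<-≤ {y = y} {u} x<y u≤v = <-≤-trans (⊕-monoˡ-< u x<y) (⊕-monoʳ-≤ y u≤v)

⊕-mono-≤ : ∀ {x y u v} → x ≤ y → u ≤ v → x ⊕ u ≤ y ⊕ v
⊕-mono-≤ {y = y} {u} x≤y u≤v = ≤-trans (⊕-monoˡ-≤ u x≤y) (⊕-monoʳ-≤ y u≤v)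

0≤⊝⇒≤ : ∀ {x y} → 𝟘 ≤ y ⊝ x → x ≤ y
0≤⊝⇒≤ (inj₁ 0<y⊝x) = inj₁ (fromPositive (0<⇒Positive 0<y⊝x))
0≤⊝⇒≤ (inj₂ 𝟘≡y⊝x) = inj₂ (⊝≡𝟘⇒≡ (sym 𝟘≡y⊝x))

≤⇒0≤⊝ : ∀ {x y} → x ≤ y → 𝟘 ≤ y ⊝ x
≤⇒0≤⊝ (inj₁ x<y) = inj₁ (Positive⇒0< (toPositive x<y))
≤⇒0≤⊝ {x} (inj₂ refl) = inj₂ (sym (⊝-self x))

<⇒0<⊝ : ∀ {x y} → x < y → 𝟘 < y ⊝ x
<⇒0<⊝ x<y = Positive⇒0< (toPositive x<y)

x≤x⊕y : ∀ {x y} → 𝟘 ≤ y → x ≤ x ⊕ y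
x≤x⊕y {x} {y} 0≤y = subst (_≤ x ⊕ y) (⊕-identityʳ x) (⊕-monoʳ-≤ x 0≤y)

x<x⊕y : ∀ {x y} → 𝟘 < y → x < x ⊕ y
x<x⊕y {x} {y} 0<y = subst (_< x ⊕ y) (⊕-identityʳ x) (⊕-monoʳ-< x 0<y)

x⊝y<x : ∀ {x y} → 𝟘 < y → x ⊝ y < x
x⊝y<x {x} {y} = <-respᵈ (e x y)
  where
  e : ∀ x y → y ⊝ 𝟘 ≡ x ⊝ (x ⊝ y)
  e (mk a b) (mk c d) = cong₂ mk (solve (a ∷ c ∷ [])) (solve (b ∷ d ∷ []))

⊝-monoʳ-< : ∀ x {y z} → y < z → x ⊝ z < x ⊝ y
⊝-monoʳ-< x {y} {z} = <-respᵈ (e x y z)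
  where
  e : ∀ x y z → z ⊝ y ≡ (x ⊝ y) ⊝ (x ⊝ z)
  e (mk a b) (mk c d) (mk e f) = cong₂ mk (solve (a ∷ c ∷ e ∷ [])) (solve (b ∷ d ∷ f ∷ []))

⊝-monoʳ-≤ : ∀ x {y z} → y ≤ z → x ⊝ z ≤ x ⊝ y
⊝-monoʳ-≤ x (inj₁ y<z) = <⇒≤ (⊝-monoʳ-< x y<z)
⊝-monoʳ-≤ x (inj₂ refl) = ≤-refl

≤-⊝⇒⊕-≤ : ∀ {x y z} → z ≤ y ⊝ x → x ⊕ z ≤ y
≤-⊝⇒⊕-≤ {x} {y} {z} z≤y-x = 0≤⊝⇒≤ (subst (𝟘 ≤_) (e x y z) (≤⇒0≤⊝ z≤y-x))
  where
  e : ∀ x y z → (y ⊝ x) ⊝ z ≡ y ⊝ (x ⊕ z)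
  e (mk a b) (mk c d) (mk e f) = cong₂ mk (solve (a ∷ c ∷ e ∷ [])) (solve (b ∷ d ∷ f ∷ []))

⊕-≤⇒≤-⊝ : ∀ {x y z} → x ⊕ z ≤ y → x ≤ y ⊝ z
⊕-≤⇒≤-⊝ {x} {y} {z} x+z≤y = 0≤⊝⇒≤ (subst (𝟘 ≤_) (e x y z) (≤⇒0≤⊝ x+z≤y))
  where
  e : ∀ x y z → y ⊝ (x ⊕ z) ≡ (y ⊝ z) ⊝ x
  e (mk a b) (mk c d) (mk e f) = cong₂ mk (solve (a ∷ c ∷ e ∷ [])) (solve (b ∷ d ∷ f ∷ []))

ϕ⁻¹·-mono-< : ∀ {x y} → x < y → ϕ⁻¹· x < ϕ⁻¹· y
ϕ⁻¹·-mono-< {x} {y} (fromPositive p) = fromPositive (subst Positive (ϕ⁻¹·-⊝ y x) (Positive-ϕ⁻¹· p))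

ϕ⁻¹·-mono-≤ : ∀ {x y} → x ≤ y → ϕ⁻¹· x ≤ ϕ⁻¹· y
ϕ⁻¹·-mono-≤ (inj₁ x<y) = <⇒≤ (ϕ⁻¹·-mono-< x<y)
ϕ⁻¹·-mono-≤ (inj₂ refl) = ≤-refl

ϕ^-<⇒< : ∀ k {x y} → ϕ^ k · x < ϕ^ k · y → x < y
ϕ^-<⇒< k {x} {y} (fromPositive p) = fromPositive (ϕ^-reflects-Positive k (subst Positive (sym (ϕ^-⊝ k y x)) p))

ϕ⁻^-positive : ∀ k → 𝟘 < ϕ⁻^ k
ϕ⁻^-positive zero = Positive⇒0< {𝟙} (1 , positiveCoeffs 0≤+ 0<+[1+])
ϕ⁻^-positive (suc k) = Positive⇒0< (Positive-ϕ⁻¹· (0<⇒Positive (ϕ⁻^-positive k)))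

ϕ⁻^-split : ∀ n → ϕ⁻^ n ≡ ϕ⁻^ suc n ⊕ ϕ⁻^ suc (suc n)
ϕ⁻^-split n = e (ϕ⁻^ n)
  where
  e : ∀ x → x ≡ ϕ⁻¹· x ⊕ ϕ⁻¹· (ϕ⁻¹· x)
  e (mk a b) = cong₂ mk (solve (a ∷ b ∷ [])) (solve (a ∷ b ∷ []))

ϕ⁻^-decreasing : ∀ n → ϕ⁻^ suc n < ϕ⁻^ n
ϕ⁻^-decreasing n = subst (ϕ⁻^ suc n <_) (sym (ϕ⁻^-split n)) (x<x⊕y (ϕ⁻^-positive (suc (suc n))))

ϕ⁻^-antitone : ∀ n j → ϕ⁻^ (n ℕ.+ j) ≤ ϕ⁻^ n
ϕ⁻^-antitone n zero = inj₂ (cong ϕ⁻^_ (ℕP.+-identityʳ n))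
ϕ⁻^-antitone n (suc j) = <⇒≤ (<-≤-trans (subst (λ k → ϕ⁻^ k < ϕ⁻^ (n ℕ.+ j)) (sym (ℕP.+-suc n j)) (ϕ⁻^-decreasing (n ℕ.+ j)))
                                         (ϕ⁻^-antitone n j))

ϕ⁻²<1 : ϕ⁻^ 2 < 𝟙
ϕ⁻²<1 = <-trans (ϕ⁻^-decreasing 1) (ϕ⁻^-decreasing 0)

ι-nonneg : ∀ {n} → + 0 ℤ.≤ n → 𝟘 ≤ ι n
ι-nonneg {+ 0} _ = ≤-refl
ι-nonneg {+[1+ m ]} _ = inj₁ (Positive⇒0< {ι +[1+ m ]} (1 , positiveCoeffs 0≤+ 0<+[1+]))

infixl 7 _⊓_

_⊓_ : ℤ[ϕ] → ℤ[ϕ] → ℤ[ϕ]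
x ⊓ y with x <? y
... | yes _ = x
... | no _ = y

⊓-≤ˡ : ∀ x y → x ⊓ y ≤ x
⊓-≤ˡ x y with x <? y
... | yes _ = ≤-refl
... | no x≮y = ≮⇒≥ x≮y

⊓-≤ʳ : ∀ x y → x ⊓ y ≤ y
⊓-≤ʳ x y with x <? y
... | yes x<y = <⇒≤ x<y
... | no _ = ≤-refl

⊓-glb : ∀ {x y z} → z < x → z < y → z < x ⊓ y
⊓-glb {x} {y} z<x z<y with x <? y
... | yes _ = z<x
... | no _ = z<y

-- Archimedean property

infixr 7 _⨯_

_⨯_ : ℕ → ℤ[ϕ] → ℤ[ϕ]
zero ⨯ x = 𝟘
suc n ⨯ x = n ⨯ x ⊕ x

⨯-mono-≤ : ∀ n {x y} → x ≤ y → n ⨯ x ≤ n ⨯ y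
⨯-mono-≤ zero _ = ≤-refl
⨯-mono-≤ (suc n) x≤y = ⊕-mono-≤ (⨯-mono-≤ n x≤y) x≤y

ϕ^-⨯ : ∀ k n x → ϕ^ k · (n ⨯ x) ≡ n ⨯ ϕ^ k · x
ϕ^-⨯ k zero x = ϕ^-𝟘 k
ϕ^-⨯ k (suc n) x = trans (ϕ^-⊕ k (n ⨯ x) x) (cong (_⊕ ϕ^ k · x) (ϕ^-⨯ k n x))

⨯-𝟙 : ∀ n → n ⨯ 𝟙 ≡ ι (+ n)
⨯-𝟙 zero = refl
⨯-𝟙 (suc n) = trans (cong (_⊕ 𝟙) (⨯-𝟙 n)) (cong (λ m → ι (+ m)) (ℕP.+-comm n 1))

-- If ϕᴷδ = a + bϕ with a ≥ 0 and b > 0, then ϕᴷδ - ϕ⁻¹ = (a + 1) + (b - 1)ϕ > 0.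
ϕ⁻^-below : ∀ {δ} → 𝟘 < δ → ∃[ K ] ϕ⁻^ K < δ
ϕ⁻^-below {δ} 0<δ with 0<⇒Positive 0<δ
... | K , c = suc K , ϕ^-<⇒< K (subst (_< ϕ^ K · δ) (sym ϕᴷϕ⁻¹⁻ᴷ) (fromPositive (1 , step c)))
  where
  ϕᴷϕ⁻¹⁻ᴷ : ϕ^ K · ϕ⁻^ suc K ≡ ϕ⁻^ 1
  ϕᴷϕ⁻¹⁻ᴷ = trans (cong (ϕ^ K ·_) (sym (ϕ⁻^-comm K 𝟙))) (ϕ^-ϕ⁻^ K (ϕ⁻^ 1))
  step : ∀ {y} → PositiveCoeffs y → PositiveCoeffs (ϕ· (y ⊝ ϕ⁻^ 1))
  step (positiveCoeffs 0≤a 0<b) = positiveCoeffs (ℤP.i≤j⇒0≤j-i (ℤP.i<j⇒suc[i]≤j 0<b))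
    (ℤP.+-mono-<-≤ (ℤP.+-mono-≤-< 0≤a 0<+[1+]) (ℤP.i≤j⇒0≤j-i (ℤP.i<j⇒suc[i]≤j 0<b)))

ϕ^-natural : ∀ k a b → ∃[ a′ ] ∃[ b′ ] ϕ^ k · mk (+ a) (+ b) ≡ mk (+ a′) (+ b′)
ϕ^-natural zero a b = a , b , refl
ϕ^-natural (suc k) a b = ϕ^-natural k b (a ℕ.+ b)

1+nϕ⁻²-positive : ∀ n → 𝟘 < mk (+ 1 ℤ.+ (+ n ℤ.+ + n)) (ℤ.- + n)
1+nϕ⁻²-positive zero = ϕ⁻^-positive 0
1+nϕ⁻²-positive (suc n) = subst (𝟘 <_) (sym (cong₂ mk (e₀ (+ n)) (e₁ (+ n))))
  (<-trans (1+nϕ⁻²-positive n) (x<x⊕y (ϕ⁻^-positive 2)))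
  where
  e₀ : ∀ n → + 1 ℤ.+ ((+ 1 ℤ.+ n) ℤ.+ (+ 1 ℤ.+ n)) ≡ (+ 1 ℤ.+ (n ℤ.+ n)) ℤ.+ + 2
  e₀ = solve-∀
  e₁ : ∀ n → ℤ.- (+ 1 ℤ.+ n) ≡ ℤ.- n ℤ.+ -[1+ 0 ]
  e₁ = solve-∀

-- ϕᵏ = a + bϕ < a + 2b + 1, because a + 2b + 1 - ϕᵏ = 1 + bϕ⁻² > 0.
archimedean-ϕ⁻^ : ∀ k → ∃[ N ] 𝟙 < N ⨯ ϕ⁻^ k
archimedean-ϕ⁻^ k with ϕ^-natural k 1 0
... | a , b , ϕᵏ≡ = N , ϕ^-<⇒< k (subst₂ _<_ (sym ϕᵏ≡) (sym ϕᵏNϕ⁻ᵏ) (<-respᵈ e (1+nϕ⁻²-positive b)))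
  where
  N = suc (a ℕ.+ (b ℕ.+ b))
  ϕᵏNϕ⁻ᵏ : ϕ^ k · (N ⨯ ϕ⁻^ k) ≡ ι (+ N)
  ϕᵏNϕ⁻ᵏ = trans (ϕ^-⨯ k N (ϕ⁻^ k)) (trans (cong (N ⨯_) (ϕ^-ϕ⁻^ k 𝟙)) (⨯-𝟙 N))
  e : mk (+ 1 ℤ.+ (+ b ℤ.+ + b)) (ℤ.- + b) ⊝ 𝟘 ≡ ι (+ N) ⊝ mk (+ a) (+ b)
  e = cong₂ mk (e₀ (+ a) (+ b)) (e₁ (+ b))
    where
    e₀ : ∀ a b → (+ 1 ℤ.+ (b ℤ.+ b)) ℤ.- + 0 ≡ (+ 1 ℤ.+ (a ℤ.+ (b ℤ.+ b))) ℤ.- a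
    e₀ = solve-∀
    e₁ : ∀ b → ℤ.- b ℤ.- + 0 ≡ + 0 ℤ.- b
    e₁ = solve-∀

archimedean : ∀ {δ} → 𝟘 < δ → ∃[ N ] 𝟙 < N ⨯ δ
archimedean 0<δ with ϕ⁻^-below 0<δ
... | K , ϕ⁻ᴷ<δ with archimedean-ϕ⁻^ K
... | N , 1<Nϕ⁻ᴷ = N , <-≤-trans 1<Nϕ⁻ᴷ (⨯-mono-≤ N (<⇒≤ ϕ⁻ᴷ<δ))

-- The rotation by β

InUnit : ℤ[ϕ] → Set
InUnit x = 𝟘 ≤ x × x < 𝟙

-- Two points of [0, 1) with the same ϕ-coefficient differ by an integer, hence agree.
InUnit-c₀-≮ : ∀ {x y} → InUnit x → InUnit y → c₁ x ≡ c₁ y → ¬ c₀ x ℤ.< c₀ y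
InUnit-c₀-≮ {mk a b} {mk c .b} (0≤x , _) (_ , y<1) refl a<c = ≤⇒≯ 1≤y y<1
  where
  open ≤-Reasoning
  1≤y : 𝟙 ≤ mk c b
  1≤y = begin
    𝟙                                       ≡⟨ sym (⊕-identityˡ 𝟙) ⟩
    𝟘 ⊕ 𝟙                                   ≤⟨ ⊕-monoˡ-≤ 𝟙 0≤x ⟩
    mk a b ⊕ 𝟙                              ≤⟨ x≤x⊕y (ι-nonneg (ℤP.i≤j⇒0≤j-i (ℤP.i<j⇒suc[i]≤j a<c))) ⟩
    (mk a b ⊕ 𝟙) ⊕ ι (c ℤ.- (+ 1 ℤ.+ a))   ≡⟨ cong₂ mk (solve (a ∷ c ∷ [])) (solve (b ∷ [])) ⟩
    mk c b                                  ∎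

InUnit-unique : ∀ {x y} → InUnit x → InUnit y → c₁ x ≡ c₁ y → x ≡ y
InUnit-unique {mk a b} {mk c d} x∈ y∈ b≡d with ℤP.<-cmp a c
... | tri< a<c _ _ = ⊥-elim (InUnit-c₀-≮ x∈ y∈ b≡d a<c)
... | tri≈ _ a≡c _ = cong₂ mk a≡c b≡d
... | tri> _ _ c<a = ⊥-elim (InUnit-c₀-≮ y∈ x∈ (sym b≡d) c<a)

carry : ℤ[ϕ] → ℕ
carry x with x <? ϕ⁻^ 2
... | yes _ = 0
... | no _ = 1

carry-cases : ∀ x → (x < ϕ⁻^ 2 × carry x ≡ 0) ⊎ (ϕ⁻^ 2 ≤ x × carry x ≡ 1)
carry-cases x with x <? ϕ⁻^ 2
... | yes x<ϕ⁻² = inj₁ (x<ϕ⁻² , refl)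
... | no x≮ϕ⁻² = inj₂ (≮⇒≥ x≮ϕ⁻² , refl)

carry-< : ∀ {x} → x < ϕ⁻^ 2 → carry x ≡ 0
carry-< {x} x<ϕ⁻² with carry-cases x
... | inj₁ (_ , c≡0) = c≡0
... | inj₂ (ϕ⁻²≤x , _) = ⊥-elim (≤⇒≯ ϕ⁻²≤x x<ϕ⁻²)

carry-≥ : ∀ {x} → ϕ⁻^ 2 ≤ x → carry x ≡ 1
carry-≥ {x} ϕ⁻²≤x with carry-cases x
... | inj₁ (x<ϕ⁻² , _) = ⊥-elim (≤⇒≯ ϕ⁻²≤x x<ϕ⁻²)
... | inj₂ (_ , c≡1) = c≡1

-- With β = ϕ⁻¹ = ϕ - 1, floorβ n = ⌊nβ⌋ and fracβ n = nβ - ⌊nβ⌋; the carry is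
-- 1 exactly when adding β to the fractional part overflows 1 = β + β².
floorβ : ℕ → ℕ
fracβ : ℕ → ℤ[ϕ]

floorβ zero = 0
floorβ (suc n) = floorβ n ℕ.+ carry (fracβ n)

fracβ n = mk (ℤ.- (+ n) ℤ.- + floorβ n) (+ n)

fracβ-suc : ∀ n → fracβ (suc n) ≡ fracβ n ⊕ ϕ⁻^ 1 ⊝ ι (+ carry (fracβ n))
fracβ-suc n = cong₂ mk (e₀ (+ n) (+ floorβ n) (+ carry (fracβ n))) (e₁ (+ n))
  where
  e₀ : ∀ n f c → ℤ.- (+ 1 ℤ.+ n) ℤ.- (f ℤ.+ c) ≡ (ℤ.- n ℤ.- f) ℤ.+ (+ 0 ℤ.- + 1) ℤ.- c
  e₀ = solve-∀
  e₁ : ∀ n → + 1 ℤ.+ n ≡ n ℤ.+ + 1 ℤ.- + 0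
  e₁ = solve-∀

fracβ-suc-< : ∀ n → carry (fracβ n) ≡ 0 → fracβ (suc n) ≡ fracβ n ⊕ ϕ⁻^ 1
fracβ-suc-< n c≡0 = trans (fracβ-suc n) (trans (cong (λ c → fracβ n ⊕ ϕ⁻^ 1 ⊝ ι (+ c)) c≡0) (⊝-identityʳ _))

fracβ-suc-≥ : ∀ n → carry (fracβ n) ≡ 1 → fracβ (suc n) ≡ fracβ n ⊝ ϕ⁻^ 2
fracβ-suc-≥ n c≡1 = trans (fracβ-suc n) (trans (cong (λ c → fracβ n ⊕ ϕ⁻^ 1 ⊝ ι (+ c)) c≡1) (e (fracβ n)))
  where
  e : ∀ x → x ⊕ ϕ⁻^ 1 ⊝ 𝟙 ≡ x ⊝ ϕ⁻^ 2
  e (mk a b) = cong₂ mk (solve (a ∷ [])) (solve (b ∷ []))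

fracβ-inUnit : ∀ n → InUnit (fracβ n)
fracβ-inUnit zero = ≤-refl , ϕ⁻^-positive 0
fracβ-inUnit (suc n) with fracβ-inUnit n | carry-cases (fracβ n)
... | 0≤x , _ | inj₁ (x<ϕ⁻² , c≡0) = subst InUnit (sym (fracβ-suc-< n c≡0))
  (≤-trans 0≤x (x≤x⊕y (<⇒≤ (ϕ⁻^-positive 1))) , ⊕-monoˡ-< (ϕ⁻^ 1) x<ϕ⁻²)
... | _ , x<1 | inj₂ (ϕ⁻²≤x , c≡1) = subst InUnit (sym (fracβ-suc-≥ n c≡1))
  (≤⇒0≤⊝ ϕ⁻²≤x , <-trans (x⊝y<x (ϕ⁻^-positive 2)) x<1)

fracβ-suc-positive : ∀ n → 𝟘 < fracβ (suc n)
fracβ-suc-positive n with proj₁ (fracβ-inUnit (suc n))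
... | inj₁ 0<x = 0<x
... | inj₂ 𝟘≡x with () ← cong c₁ 𝟘≡x

fracβ-suc-≢-ϕ⁻² : ∀ n → fracβ (suc n) ≢ ϕ⁻^ 2
fracβ-suc-≢-ϕ⁻² n x≡ϕ⁻² with () ← cong c₁ x≡ϕ⁻²

-- The Fibonacci word is Sturmian

-- The coding of the rotation by β for the partition [0, β²) ∪ [β², 1):
-- letter n is 1 iff (n+1)β mod 1 < β².
sturmian : ℕ → ℕ
sturmian n = 1 ℕ.∸ carry (fracβ (suc n))

-- φ maps letter n to the block starting at n + ⌊(n+1)β⌋; with R = fracβ (n+1),
-- the rotation is there at 1 - βR, and one step later at β(1 - R).
sturmian-φ-start : ∀ n → sturmian (n ℕ.+ floorβ (suc n)) ≡ 0
sturmian-φ-start n = cong (1 ℕ.∸_) (carry-≥ (subst (ϕ⁻^ 2 ≤_) (sym image) ϕ⁻²≤1-βR))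
  where
  R = fracβ (suc n)
  0<βR : 𝟘 < ϕ⁻¹· R
  0<βR = ϕ⁻¹·-mono-< (fracβ-suc-positive n)
  βR<β : ϕ⁻¹· R < ϕ⁻^ 1
  βR<β = ϕ⁻¹·-mono-< (proj₂ (fracβ-inUnit (suc n)))
  ϕ⁻²≤1-βR : ϕ⁻^ 2 ≤ 𝟙 ⊝ ϕ⁻¹· R
  ϕ⁻²≤1-βR = <⇒≤ (⊝-monoʳ-< 𝟙 βR<β)
  1-βR∈ : InUnit (𝟙 ⊝ ϕ⁻¹· R)
  1-βR∈ = ≤⇒0≤⊝ (<⇒≤ (<-trans βR<β (ϕ⁻^-decreasing 0))) , x⊝y<x 0<βR
  image : fracβ (suc (n ℕ.+ floorβ (suc n))) ≡ 𝟙 ⊝ ϕ⁻¹· R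
  image = InUnit-unique (fracβ-inUnit _) 1-βR∈ (e (+ suc n) (+ floorβ (suc n)))
    where
    e : ∀ a c → a ℤ.+ c ≡ + 0 ℤ.- (ℤ.- a ℤ.- c)
    e = solve-∀

sturmian-φ-end : ∀ n → carry (fracβ (suc n)) ≡ 1 → sturmian (suc (n ℕ.+ floorβ (suc n))) ≡ 1
sturmian-φ-end n c≡1 = cong (1 ℕ.∸_) (carry-< (subst (_< ϕ⁻^ 2) (sym image) β[1-R]<ϕ⁻²))
  where
  open ≤-Reasoning
  R = fracβ (suc n)
  ϕ⁻²<R : ϕ⁻^ 2 < R
  ϕ⁻²<R with carry-cases R
  ... | inj₁ (_ , c≡0) with () ← trans (sym c≡0) c≡1
  ... | inj₂ (inj₁ ϕ⁻²<R , _) = ϕ⁻²<R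
  ... | inj₂ (inj₂ ϕ⁻²≡R , _) = ⊥-elim (fracβ-suc-≢-ϕ⁻² n (sym ϕ⁻²≡R))
  β[1-R]<ϕ⁻² : ϕ⁻¹· (𝟙 ⊝ R) < ϕ⁻^ 2
  β[1-R]<ϕ⁻² = ϕ⁻¹·-mono-< (⊝-monoʳ-< 𝟙 ϕ⁻²<R)
  β[1-R]∈ : InUnit (ϕ⁻¹· (𝟙 ⊝ R))
  β[1-R]∈ = <⇒≤ (ϕ⁻¹·-mono-< (<⇒0<⊝ (proj₂ (fracβ-inUnit (suc n))))) ,
    (begin-strict
      ϕ⁻¹· (𝟙 ⊝ R)   ≤⟨ ϕ⁻¹·-mono-≤ (⊝-monoʳ-≤ 𝟙 (proj₁ (fracβ-inUnit (suc n)))) ⟩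
      ϕ⁻¹· (𝟙 ⊝ 𝟘)   <⟨ ϕ⁻^-decreasing 0 ⟩
      𝟙              ∎)
  image : fracβ (suc (suc (n ℕ.+ floorβ (suc n)))) ≡ ϕ⁻¹· (𝟙 ⊝ R)
  image = InUnit-unique (fracβ-inUnit _) β[1-R]∈ (e (+ suc n) (+ floorβ (suc n)))
    where
    e : ∀ a c → + 1 ℤ.+ a ℤ.+ c ≡ + 1 ℤ.- (ℤ.- a ℤ.- c)
    e = solve-∀

φ-∷ʳ : ∀ l x → φ (l ∷ʳ x) ≡ φ l ++ φ₁ x
φ-∷ʳ l x = trans (LP.concatMap-++ φ₁ l [ x ]) (cong (φ l ++_) (LP.++-identityʳ (φ₁ x)))

φ-sturmian : ∀ n → φ (applyUpTo sturmian n) ≡ applyUpTo sturmian (n ℕ.+ floorβ (suc n))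
φ-sturmian zero = refl
φ-sturmian (suc n) with carry-cases (fracβ (suc n))
... | inj₁ (_ , c≡0) = begin
    φ (applyUpTo s (suc n))               ≡⟨ cong φ (sym (LP.applyUpTo-∷ʳ s n)) ⟩
    φ (applyUpTo s n ∷ʳ s n)              ≡⟨ φ-∷ʳ (applyUpTo s n) (s n) ⟩
    φ (applyUpTo s n) ++ φ₁ (s n)         ≡⟨ cong₂ _++_ (φ-sturmian n) (cong (λ c → φ₁ (1 ℕ.∸ c)) c≡0) ⟩
    applyUpTo s P ∷ʳ 0                    ≡⟨ cong (applyUpTo s P ∷ʳ_) (sym (sturmian-φ-start n)) ⟩
    applyUpTo s P ∷ʳ s P                  ≡⟨ LP.applyUpTo-∷ʳ s P ⟩
    applyUpTo s (suc P)                   ≡⟨ cong (λ c → applyUpTo s (suc n ℕ.+ c)) (sym (trans (cong (C ℕ.+_) c≡0) (ℕP.+-identityʳ C))) ⟩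
    applyUpTo s (suc n ℕ.+ floorβ (suc (suc n))) ∎
  where
  open ≡-Reasoning
  s = sturmian
  C = floorβ (suc n)
  P = n ℕ.+ C
... | inj₂ (_ , c≡1) = begin
    φ (applyUpTo s (suc n))               ≡⟨ cong φ (sym (LP.applyUpTo-∷ʳ s n)) ⟩
    φ (applyUpTo s n ∷ʳ s n)              ≡⟨ φ-∷ʳ (applyUpTo s n) (s n) ⟩
    φ (applyUpTo s n) ++ φ₁ (s n)         ≡⟨ cong₂ _++_ (φ-sturmian n) (cong (λ c → φ₁ (1 ℕ.∸ c)) c≡1) ⟩
    applyUpTo s P ++ 0 ∷ 1 ∷ []           ≡⟨ sym (LP.++-assoc (applyUpTo s P) [ 0 ] [ 1 ]) ⟩
    applyUpTo s P ∷ʳ 0 ∷ʳ 1               ≡⟨ cong₂ (λ a b → applyUpTo s P ∷ʳ a ∷ʳ b) (sym (sturmian-φ-start n)) (sym (sturmian-φ-end n c≡1)) ⟩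
    applyUpTo s P ∷ʳ s P ∷ʳ s (suc P)     ≡⟨ cong (_∷ʳ s (suc P)) (LP.applyUpTo-∷ʳ s P) ⟩
    applyUpTo s (suc P) ∷ʳ s (suc P)      ≡⟨ LP.applyUpTo-∷ʳ s (suc P) ⟩
    applyUpTo s (suc (suc P))             ≡⟨ cong (λ m → applyUpTo s (suc m)) (sym index) ⟩
    applyUpTo s (suc n ℕ.+ floorβ (suc (suc n))) ∎
  where
  open ≡-Reasoning
  s = sturmian
  C = floorβ (suc n)
  P = n ℕ.+ C
  index : n ℕ.+ floorβ (suc (suc n)) ≡ suc P
  index = trans (cong (λ c → n ℕ.+ (C ℕ.+ c)) c≡1) (trans (cong (n ℕ.+_) (ℕP.+-comm C 1)) (ℕP.+-suc n C))

floorβ-positive : ∀ m → 1 ℕ.≤ floorβ (suc (suc m))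
floorβ-positive zero = ℕP.≤-refl
floorβ-positive (suc m) = ℕP.≤-trans (floorβ-positive m) (ℕP.m≤m+n _ _)

φ^-length : ℕ → ℕ
φ^-length zero = 1
φ^-length (suc k) = φ^-length k ℕ.+ floorβ (suc (φ^-length k))

φ^-sturmian : ∀ k → φ^ k ≡ applyUpTo sturmian (φ^-length k)
φ^-sturmian zero = refl
φ^-sturmian (suc k) = trans (cong φ (φ^-sturmian k)) (φ-sturmian (φ^-length k))

k<φ^-length : ∀ k → k ℕ.< φ^-length k
k<φ^-length zero = ℕP.≤-refl
k<φ^-length (suc k) with φ^-length k | k<φ^-length k
... | suc m | k<1+m = subst (ℕ._≤ suc m ℕ.+ floorβ (suc (suc m))) (ℕP.+-comm (suc k) 1)
                        (ℕP.+-mono-≤ k<1+m (floorβ-positive m))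

nth-applyUpTo : ∀ (f : ℕ → ℕ) {n k} → k ℕ.< n → nth (applyUpTo f n) k ≡ f k
nth-applyUpTo f {suc n} {zero} _ = refl
nth-applyUpTo f {suc n} {suc k} (s≤s k<n) = nth-applyUpTo (λ i → f (suc i)) k<n

fib≡sturmian : ∀ k → fib k ≡ sturmian k
fib≡sturmian k = trans (cong (λ l → nth l k) (φ^-sturmian (suc k)))
  (nth-applyUpTo sturmian (ℕP.<-trans (ℕP.n<1+n k) (k<φ^-length (suc k))))

-- Recurrence of prefixes

Occ-applyUpTo : ∀ (w u : Word) k n → (∀ t → t ℕ.< k → w (n ℕ.+ t) ≡ u t) → Occ w (applyUpTo u k) n
Occ-applyUpTo w u zero n _ = tt
Occ-applyUpTo w u (suc k) n agree =
  trans (cong w (sym (ℕP.+-identityʳ n))) (agree 0 (s≤s z≤n)) ,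
  Occ-applyUpTo w (λ t → u (suc t)) k (suc n)
    (λ t t<k → trans (cong w (sym (ℕP.+-suc n t))) (agree (suc t) (s≤s t<k)))

Occ-prefix : ∀ (w u : Word) k n → (∀ t → t ℕ.< k → w (n ℕ.+ t) ≡ u t) → Occ w (prefix u k) n
Occ-prefix w u k n agree = subst (λ v → Occ w v n) (sym (LP.map-upTo u k)) (Occ-applyUpTo w u k n agree)

Occ-gword : ∀ v n → Occ fib v n → Occ gword v (suc n)
Occ-gword [] n _ = tt
Occ-gword (a ∷ v) n (fn≡a , occ) = fn≡a , Occ-gword v (suc n) occ

-- q keeps distance δ from the points 0 and β² that cut the circle ℝ/ℤ into the two letters.
record Far (δ q : ℤ[ϕ]) : Set where
  field
    above-0 : δ ≤ q
    below-1 : q ⊕ δ ≤ 𝟙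
    off-cut : q ⊕ δ ≤ ϕ⁻^ 2 ⊎ ϕ⁻^ 2 ⊕ δ ≤ q

Near : ℤ[ϕ] → ℤ[ϕ] → Set
Near δ e = e < δ ⊎ 𝟙 < e ⊕ δ

carry-≡ : ∀ {x y} → (x < ϕ⁻^ 2 → y < ϕ⁻^ 2) → (ϕ⁻^ 2 ≤ x → ϕ⁻^ 2 ≤ y) → carry y ≡ carry x
carry-≡ {x} below above with carry-cases x
... | inj₁ (x<ϕ⁻² , c≡0) = trans (carry-< (below x<ϕ⁻²)) (sym c≡0)
... | inj₂ (ϕ⁻²≤x , c≡1) = trans (carry-≥ (above ϕ⁻²≤x)) (sym c≡1)

-- c₁ s ≡ c₁ q + c₁ e says s = q + e mod 1: rotating q by less than δ keeps it off the cuts.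
carry-stable : ∀ {δ q e s} → 𝟘 < δ → Far δ q → InUnit q → InUnit e → Near δ e →
               InUnit s → c₁ s ≡ c₁ q ℤ.+ c₁ e → carry s ≡ carry q
carry-stable {δ} {q} {e} {s} 0<δ far (0≤q , q<1) (0≤e , e<1) (inj₁ e<δ) s∈ c₁s =
  subst (λ s → carry s ≡ carry q) (sym s≡q+e) (carry-≡ below above)
  where
  open Far far
  q+e<q+δ : q ⊕ e < q ⊕ δ
  q+e<q+δ = ⊕-monoʳ-< q e<δ
  s≡q+e : s ≡ q ⊕ e
  s≡q+e = InUnit-unique s∈ (⊕-mono-≤ 0≤q 0≤e , <-≤-trans q+e<q+δ below-1) (trans c₁s (sym (c₁-⊕ q e)))
  below : q < ϕ⁻^ 2 → q ⊕ e < ϕ⁻^ 2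
  below q<ϕ⁻² with off-cut
  ... | inj₁ q+δ≤ϕ⁻² = <-≤-trans q+e<q+δ q+δ≤ϕ⁻²
  ... | inj₂ ϕ⁻²+δ≤q = ⊥-elim (<-asym q<ϕ⁻² (<-≤-trans (x<x⊕y 0<δ) ϕ⁻²+δ≤q))
  above : ϕ⁻^ 2 ≤ q → ϕ⁻^ 2 ≤ q ⊕ e
  above ϕ⁻²≤q = ≤-trans ϕ⁻²≤q (x≤x⊕y 0≤e)
carry-stable {δ} {q} {e} {s} 0<δ far (0≤q , q<1) (0≤e , e<1) (inj₂ 1<e+δ) s∈ c₁s =
  subst (λ s → carry s ≡ carry q) (sym s≡q+e-1) (carry-≡ below above)
  where
  open Far far
  q-δ<q+e-1 : q ⊝ δ < q ⊕ e ⊝ 𝟙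
  q-δ<q+e-1 = <-respᵈ (eq q e δ) 1<e+δ
    where
    eq : ∀ q e δ → (e ⊕ δ) ⊝ 𝟙 ≡ (q ⊕ e ⊝ 𝟙) ⊝ (q ⊝ δ)
    eq (mk a b) (mk c d) (mk e f) = cong₂ mk (solve (a ∷ c ∷ e ∷ [])) (solve (b ∷ d ∷ f ∷ []))
  q+e-1<q : q ⊕ e ⊝ 𝟙 < q
  q+e-1<q = <-respᵈ (eq q e) e<1
    where
    eq : ∀ q e → 𝟙 ⊝ e ≡ q ⊝ (q ⊕ e ⊝ 𝟙)
    eq (mk a b) (mk c d) = cong₂ mk (solve (a ∷ c ∷ [])) (solve (b ∷ d ∷ []))
  s≡q+e-1 : s ≡ q ⊕ e ⊝ 𝟙
  s≡q+e-1 = InUnit-unique s∈ (<⇒≤ (≤-<-trans (≤⇒0≤⊝ above-0) q-δ<q+e-1) , <-trans q+e-1<q q<1)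
    (trans c₁s (trans (sym (c₁-⊕ q e)) (sym (c₁-⊝𝟙 (q ⊕ e)))))
  below : q < ϕ⁻^ 2 → q ⊕ e ⊝ 𝟙 < ϕ⁻^ 2
  below = <-trans q+e-1<q
  above : ϕ⁻^ 2 ≤ q → ϕ⁻^ 2 ≤ q ⊕ e ⊝ 𝟙
  above ϕ⁻²≤q with off-cut
  ... | inj₁ q+δ≤ϕ⁻² = ⊥-elim (≤⇒≯ ϕ⁻²≤q (<-≤-trans (x<x⊕y 0<δ) q+δ≤ϕ⁻²))
  ... | inj₂ ϕ⁻²+δ≤q = <⇒≤ (≤-<-trans (⊕-≤⇒≤-⊝ ϕ⁻²+δ≤q) q-δ<q+e-1)

Far-anti : ∀ {δ δ′ q} → δ′ ≤ δ → Far δ q → Far δ′ q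
Far-anti {q = q} δ′≤δ far = record
  { above-0 = ≤-trans δ′≤δ above-0
  ; below-1 = ≤-trans (⊕-monoʳ-≤ q δ′≤δ) below-1
  ; off-cut = Sum.map (≤-trans (⊕-monoʳ-≤ q δ′≤δ)) (≤-trans (⊕-monoʳ-≤ (ϕ⁻^ 2) δ′≤δ)) off-cut
  }
  where open Far far

Far-from-gap : ∀ {q} gap → 𝟘 < q → q < 𝟙 → 𝟘 < gap →
               (∀ {δ} → δ ≤ gap → q ⊕ δ ≤ ϕ⁻^ 2 ⊎ ϕ⁻^ 2 ⊕ δ ≤ q) → ∃[ δ ] (𝟘 < δ × Far δ q)
Far-from-gap {q} gap 0<q q<1 0<gap off = q ⊓ (u ⊓ gap) , ⊓-glb 0<q (⊓-glb (<⇒0<⊝ q<1) 0<gap) , record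
  { above-0 = ⊓-≤ˡ q (u ⊓ gap)
  ; below-1 = ≤-⊝⇒⊕-≤ (≤-trans (⊓-≤ʳ q (u ⊓ gap)) (⊓-≤ˡ u gap))
  ; off-cut = off (≤-trans (⊓-≤ʳ q (u ⊓ gap)) (⊓-≤ʳ u gap))
  }
  where u = 𝟙 ⊝ q

Far-exists : ∀ {q} → 𝟘 < q → q < 𝟙 → q ≢ ϕ⁻^ 2 → ∃[ δ ] (𝟘 < δ × Far δ q)
Far-exists {q} 0<q q<1 q≢ϕ⁻² with <-cmp q (ϕ⁻^ 2)
... | tri< q<ϕ⁻² _ _ = Far-from-gap (ϕ⁻^ 2 ⊝ q) 0<q q<1 (<⇒0<⊝ q<ϕ⁻²) (inj₁ ∘ ≤-⊝⇒⊕-≤)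
... | tri≈ _ q≡ϕ⁻² _ = ⊥-elim (q≢ϕ⁻² q≡ϕ⁻²)
... | tri> _ _ ϕ⁻²<q = Far-from-gap (q ⊝ ϕ⁻^ 2) 0<q q<1 (<⇒0<⊝ ϕ⁻²<q) (inj₂ ∘ ≤-⊝⇒⊕-≤)

prefix-window : ∀ k → ∃[ δ ] (𝟘 < δ × δ ≤ ϕ⁻^ 2 × (∀ t → t ℕ.< k → Far δ (fracβ (suc t))))
prefix-window zero = ϕ⁻^ 2 , ϕ⁻^-positive 2 , ≤-refl , λ _ ()
prefix-window (suc k) with prefix-window k
... | δ , 0<δ , δ≤ϕ⁻² , far = δ ⊓ ε , ⊓-glb 0<δ 0<ε , ≤-trans (⊓-≤ˡ δ ε) δ≤ϕ⁻² , far′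
  where
  ε-spec = Far-exists (fracβ-suc-positive k) (proj₂ (fracβ-inUnit (suc k))) (fracβ-suc-≢-ϕ⁻² k)
  ε = proj₁ ε-spec
  0<ε = proj₁ (proj₂ ε-spec)
  far′ : ∀ t → t ℕ.< suc k → Far (δ ⊓ ε) (fracβ (suc t))
  far′ t t<1+k with ℕP.m≤n⇒m<n∨m≡n (ℕP.≤-pred t<1+k)
  ... | inj₁ t<k = Far-anti (⊓-≤ˡ δ ε) (far t t<k)
  ... | inj₂ refl = Far-anti (⊓-≤ʳ δ ε) (proj₂ (proj₂ ε-spec))

prefix-occurs-near-0 : ∀ k → ∃[ δ ] (𝟘 < δ × δ ≤ ϕ⁻^ 2 × (∀ d → Near δ (fracβ d) → Occ fib (prefix fib k) d))
prefix-occurs-near-0 k with prefix-window k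
... | δ , 0<δ , δ≤ϕ⁻² , far = δ , 0<δ , δ≤ϕ⁻² , λ d near → Occ-prefix fib fib k d (λ t t<k → begin
    fib (d ℕ.+ t)                   ≡⟨ fib≡sturmian (d ℕ.+ t) ⟩
    1 ℕ.∸ carry (fracβ (suc (d ℕ.+ t)))
      ≡⟨ cong (1 ℕ.∸_) (carry-stable 0<δ (far t t<k) (fracβ-inUnit (suc t)) (fracβ-inUnit d) near (fracβ-inUnit _)
                          (cong (λ m → + suc m) (ℕP.+-comm d t))) ⟩
    1 ℕ.∸ carry (fracβ (suc t))     ≡⟨ sym (fib≡sturmian t) ⟩
    fib t                           ∎)
  where open ≡-Reasoning

-- IP*

box : ∀ N {v p} → 𝟘 ≤ p → p < N ⨯ v → ∃[ c ] (c ℕ.< N × c ⨯ v ≤ p × p < suc c ⨯ v)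
box zero 0≤p p<0 = ⊥-elim (≤⇒≯ 0≤p p<0)
box (suc n) {v} {p} 0≤p p<Nv with p <? n ⨯ v
... | yes p<nv = let c , c<n , lo , hi = box n 0≤p p<nv in c , ℕP.m<n⇒m<1+n c<n , lo , hi
... | no p≮nv = n , ℕP.n<1+n n , ≮⇒≥ p≮nv , p<Nv

same-box : ∀ {c v x y} → c ≤ x → x < c ⊕ v → y < c ⊕ v → y ⊝ x < v
same-box {c} {v} {x} {y} c≤x x<c+v y<c+v = begin-strict
  y ⊝ x          <⟨ ⊕-monoˡ-< (⊖ x) y<c+v ⟩
  (c ⊕ v) ⊝ x    ≤⟨ ⊝-monoʳ-≤ (c ⊕ v) c≤x ⟩
  (c ⊕ v) ⊝ c    ≡⟨ e c v ⟩
  v              ∎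
  where
  open ≤-Reasoning
  e : ∀ c v → (c ⊕ v) ⊝ c ≡ v
  e (mk a b) (mk c d) = cong₂ mk (solve (a ∷ c ∷ [])) (solve (b ∷ d ∷ []))

-- Pigeonhole: of N + 1 points of [0, 1) cut into N cells of width v, two share a cell.
close-pair : ∀ (p : ℕ → ℤ[ϕ]) → (∀ n → InUnit (p n)) → ∀ {v} N → 𝟙 < N ⨯ v →
             ∃[ i ] ∃[ o ] (p (i ℕ.+ suc o) ⊝ p i < v × p i ⊝ p (i ℕ.+ suc o) < v)
close-pair p p∈ {v} N 1<Nv = pair (FinP.pigeonhole (ℕP.n<1+n N) cellᶠ)
  where
  cell : ∀ n → ∃[ c ] (c ℕ.< N × c ⨯ v ≤ p n × p n < suc c ⨯ v)
  cell n = box N (proj₁ (p∈ n)) (<-trans (proj₂ (p∈ n)) 1<Nv)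
  cellᶠ : Fin (suc N) → Fin N
  cellᶠ j = fromℕ< (proj₁ (proj₂ (cell (toℕ j))))
  pair : (∃₂ λ i j → i Fin.< j × cellᶠ i ≡ cellᶠ j) →
         ∃[ i ] ∃[ o ] (p (i ℕ.+ suc o) ⊝ p i < v × p i ⊝ p (i ℕ.+ suc o) < v)
  pair (i , j , i<j , same) with ℕP.m≤n⇒∃[o]m+o≡n i<j
  ... | o , 1+i+o≡j with cell (toℕ i) | cell (toℕ j) | FinP.fromℕ<-injective _ _ _ _ same
  ... | c , _ , c≤pᵢ , pᵢ<c′ | .c , _ , c≤pⱼ , pⱼ<c′ | refl = toℕ i , o ,
    subst (λ m → p m ⊝ p (toℕ i) < v) j≡i+1+o (same-box c≤pᵢ pᵢ<c′ pⱼ<c′) ,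
    subst (λ m → p (toℕ i) ⊝ p m < v) j≡i+1+o (same-box c≤pⱼ pⱼ<c′ pᵢ<c′)
    where
    j≡i+1+o : toℕ j ≡ toℕ i ℕ.+ suc o
    j≡i+1+o = trans (sym 1+i+o≡j) (sym (ℕP.+-suc (toℕ i) o))

Near-from-close : ∀ {δ x y} d → InUnit x → InUnit y → y ⊝ x < δ → x ⊝ y < δ →
                  c₁ (y ⊝ x) ≡ + d → Near δ (fracβ d)
Near-from-close {δ} {x} {y} d (0≤x , x<1) (0≤y , y<1) y-x<δ x-y<δ c₁≡d with y <? x
... | no y≮x = inj₁ (subst (_< δ) (sym frac≡) y-x<δ)
  where
  frac≡ : fracβ d ≡ y ⊝ x
  frac≡ = InUnit-unique (fracβ-inUnit d)
    (≤⇒0≤⊝ (≮⇒≥ y≮x) , ≤-<-trans (⊝-monoʳ-≤ y 0≤x) (subst (_< 𝟙) (sym (⊝-identityʳ y)) y<1))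
    (sym c₁≡d)
... | yes y<x = inj₂ (subst (λ z → 𝟙 < z ⊕ δ) (sym frac≡) (<-respᵈ (e₂ x y δ) x-y<δ))
  where
  e₁ : ∀ x y → 𝟙 ⊝ (x ⊝ y) ≡ (y ⊝ x) ⊕ 𝟙
  e₁ (mk a b) (mk c d) = cong₂ mk (solve (a ∷ c ∷ [])) (solve (b ∷ d ∷ []))
  e₂ : ∀ x y δ → δ ⊝ (x ⊝ y) ≡ ((y ⊝ x) ⊕ 𝟙 ⊕ δ) ⊝ 𝟙
  e₂ (mk a b) (mk c d) (mk e f) = cong₂ mk (solve (a ∷ c ∷ e ∷ [])) (solve (b ∷ d ∷ f ∷ []))
  0<1-[x-y] : 𝟘 < 𝟙 ⊝ (x ⊝ y)
  0<1-[x-y] = <⇒0<⊝ (≤-<-trans (⊝-monoʳ-≤ x 0≤y) (subst (_< 𝟙) (sym (⊝-identityʳ x)) x<1))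
  y-x+1<1 : (y ⊝ x) ⊕ 𝟙 < 𝟙
  y-x+1<1 = subst ((y ⊝ x) ⊕ 𝟙 <_) (⊕-identityˡ 𝟙) (⊕-monoˡ-< 𝟙 (subst (y ⊝ x <_) (⊝-self x) (⊕-monoˡ-< (⊖ x) y<x)))
  frac≡ : fracβ d ≡ (y ⊝ x) ⊕ 𝟙
  frac≡ = InUnit-unique (fracβ-inUnit d) (<⇒≤ (subst (𝟘 <_) (e₁ x y) 0<1-[x-y]) , y-x+1<1)
    (trans (sym c₁≡d) (trans (sym (ℤP.+-identityʳ _)) (sym (c₁-⊕ (y ⊝ x) 𝟙))))

Σ< : (ℕ → ℕ) → ℕ → ℕ
Σ< x zero = 0
Σ< x (suc n) = Σ< x n ℕ.+ x n

Σ<-+ : ∀ x i m → Σ< x (i ℕ.+ m) ≡ Σ< x i ℕ.+ sum (map x (iterate suc i m))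
Σ<-+ x i zero = trans (cong (Σ< x) (ℕP.+-identityʳ i)) (sym (ℕP.+-identityʳ _))
Σ<-+ x i (suc m) = trans (cong (Σ< x) (ℕP.+-suc i m)) (trans (Σ<-+ x (suc i) m) (ℕP.+-assoc (Σ< x i) (x i) _))

iterate-suc-≥ : ∀ i m → All (i ℕ.≤_) (iterate suc i m)
iterate-suc-≥ i zero = All.[]
iterate-suc-≥ i (suc m) = ℕP.≤-refl All.∷ All.map ℕP.<⇒≤ (iterate-suc-≥ (suc i) m)

iterate-suc-unique : ∀ i m → Unique (iterate suc i m)
iterate-suc-unique i zero = AllPairs.[]
iterate-suc-unique i (suc m) = All.map ℕP.<⇒≢ (iterate-suc-≥ (suc i) m) AllPairs.∷ iterate-suc-unique (suc i) m

c₁-fracβ-⊝ : ∀ m d → c₁ (fracβ (m ℕ.+ d) ⊝ fracβ m) ≡ + d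
c₁-fracβ-⊝ m d = e (+ m) (+ d)
  where
  e : ∀ m d → (m ℤ.+ d) ℤ.- m ≡ d
  e = solve-∀

prefix-IP* : ∀ k → IPStarSet (Occ fib (prefix fib k))
prefix-IP* k B (x , _ , x-sums) with prefix-occurs-near-0 k
... | δ , 0<δ , _ , occurs with archimedean 0<δ
... | N , 1<Nδ with close-pair (λ n → fracβ (Σ< x n)) (λ n → fracβ-inUnit (Σ< x n)) N 1<Nδ
... | i , o , close₁ , close₂ = d , occurs d near , x-sums F (λ ()) (iterate-suc-unique i (suc o))
  where
  F = iterate suc i (suc o)
  d = sum (map x F)
  near : Near δ (fracβ d)
  near = Near-from-close d (fracβ-inUnit (Σ< x i)) (fracβ-inUnit (Σ< x (i ℕ.+ suc o))) close₁ close₂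
    (trans (cong (λ n → c₁ (fracβ n ⊝ fracβ (Σ< x i))) (Σ<-+ x i (suc o))) (c₁-fracβ-⊝ (Σ< x i) d))

-- IP sets from sums of Fibonacci numbers

fibNum : ℕ → ℕ
fibNum zero = 0
fibNum (suc zero) = 1
fibNum (suc (suc n)) = fibNum (suc n) ℕ.+ fibNum n

fibNum-positive : ∀ n → 1 ℕ.≤ fibNum (suc n)
fibNum-positive zero = ℕP.≤-refl
fibNum-positive (suc n) = ℕP.≤-trans (fibNum-positive n) (ℕP.m≤m+n _ _)

fibNum-<₂ : ∀ n → fibNum (suc n) ℕ.< fibNum (suc (suc (suc n)))
fibNum-<₂ n = ℕP.+-monoˡ-≤ (fibNum (suc n)) (fibNum-positive (suc n))

signed : ℕ → ℕ → ℤ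
signed zero m = + m
signed (suc n) m = ℤ.- signed n m

signed-+ : ∀ n a b → signed n (a ℕ.+ b) ≡ signed n a ℤ.+ signed n b
signed-+ zero a b = ℤP.pos-+ a b
signed-+ (suc n) a b = trans (cong ℤ.-_ (signed-+ n a b)) (ℤP.neg-distrib-+ (signed n a) (signed n b))

signed-2+ : ∀ n m → signed (suc (suc n)) m ≡ signed n m
signed-2+ n m = ℤP.neg-involutive (signed n m)

signed-even : ∀ n j m → signed (n ℕ.+ (j ℕ.+ j)) m ≡ signed n m
signed-even n zero m = cong (λ k → signed k m) (ℕP.+-identityʳ n)
signed-even n (suc j) m = begin
  signed (n ℕ.+ suc (j ℕ.+ suc j)) m       ≡⟨ cong (λ k → signed k m) (e n j) ⟩
  signed (suc (suc (n ℕ.+ (j ℕ.+ j)))) m   ≡⟨ signed-2+ (n ℕ.+ (j ℕ.+ j)) m ⟩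
  signed (n ℕ.+ (j ℕ.+ j)) m               ≡⟨ signed-even n j m ⟩
  signed n m                               ∎
  where
  open ≡-Reasoning
  e : ∀ n j → n ℕ.+ suc (j ℕ.+ suc j) ≡ suc (suc (n ℕ.+ (j ℕ.+ j)))
  e = ℕS.solve-∀

signed-0 : ∀ n → signed n 0 ≡ + 0
signed-0 zero = refl
signed-0 (suc n) = cong ℤ.-_ (signed-0 n)

ϕ⁻^-coeffs : ∀ n → ϕ⁻^ n ≡ mk (signed n (fibNum (suc n))) (signed (suc n) (fibNum n))
ϕ⁻^-coeffs zero = refl
ϕ⁻^-coeffs (suc n) = trans (cong ϕ⁻¹·_ (ϕ⁻^-coeffs n)) (cong₂ mk c₀≡ (sym (signed-2+ n _)))
  where
  c₀≡ : signed (suc n) (fibNum n) ℤ.- signed n (fibNum (suc n)) ≡ signed (suc n) (fibNum (suc (suc n)))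
  c₀≡ = begin
    ℤ.- signed n (fibNum n) ℤ.- signed n (fibNum (suc n))     ≡⟨ ℤP.neg-distrib-+ (signed n (fibNum n)) _ ⟨
    ℤ.- (signed n (fibNum n) ℤ.+ signed n (fibNum (suc n)))   ≡⟨ cong ℤ.-_ (signed-+ n _ _) ⟨
    ℤ.- signed n (fibNum n ℕ.+ fibNum (suc n))                ≡⟨ cong (λ m → ℤ.- signed n m) (ℕP.+-comm (fibNum n) _) ⟩
    signed (suc n) (fibNum (suc (suc n)))                     ∎
    where open ≡-Reasoning

Σϕ : (ℕ → ℤ[ϕ]) → List ℕ → ℤ[ϕ]
Σϕ g [] = 𝟘
Σϕ g (i ∷ F) = g i ⊕ Σϕ g F

Σϕ< : (ℕ → ℤ[ϕ]) → ℕ → ℤ[ϕ]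
Σϕ< g zero = 𝟘
Σϕ< g (suc B) = Σϕ< g B ⊕ g B

Σϕ-nonneg : ∀ {g} → (∀ i → 𝟘 ≤ g i) → ∀ F → 𝟘 ≤ Σϕ g F
Σϕ-nonneg g≥0 [] = ≤-refl
Σϕ-nonneg g≥0 (i ∷ F) = ⊕-mono-≤ (g≥0 i) (Σϕ-nonneg g≥0 F)

Σϕ-positive : ∀ {g} → (∀ i → 𝟘 < g i) → ∀ F → F ≢ [] → 𝟘 < Σϕ g F
Σϕ-positive g>0 [] F≢[] = ⊥-elim (F≢[] refl)
Σϕ-positive g>0 (i ∷ F) _ = ⊕-mono-<-≤ (g>0 i) (Σϕ-nonneg (<⇒≤ ∘ g>0) F)

c₁-Σϕ : ∀ {g} s (x : ℕ → ℕ) → (∀ i → c₁ (g i) ≡ signed s (x i)) → ∀ F → c₁ (Σϕ g F) ≡ signed s (sum (map x F))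
c₁-Σϕ s x c₁-g [] = sym (signed-0 s)
c₁-Σϕ {g} s x c₁-g (i ∷ F) =
  trans (c₁-⊕ (g i) (Σϕ g F)) (trans (cong₂ ℤ._+_ (c₁-g i) (c₁-Σϕ s x c₁-g F)) (sym (signed-+ s (x i) _)))

remove-top : ∀ (g : ℕ → ℤ[ϕ]) B F → Unique F → All (ℕ._< suc B) F →
             All (ℕ._< B) F ⊎ ∃[ F′ ] (F′ ⊆ F × Unique F′ × All (ℕ._< B) F′ × Σϕ g F ≡ g B ⊕ Σϕ g F′)
remove-top g B [] _ _ = inj₁ All.[]
remove-top g B (y ∷ F) (y∉F AllPairs.∷ uF) (y<1+B All.∷ F<1+B) with y ℕ.≟ B
... | yes refl = inj₂ (F , there , uF , All.zipWith (λ (z<1+y , y≢z) → ℕP.≤∧≢⇒< (ℕP.≤-pred z<1+y) (y≢z ∘ sym)) (F<1+B , y∉F) , refl)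
... | no y≢B with remove-top g B F uF F<1+B
...   | inj₁ F<B = inj₁ (ℕP.≤∧≢⇒< (ℕP.≤-pred y<1+B) y≢B All.∷ F<B)
...   | inj₂ (F′ , F′⊆F , uF′ , F′<B , Σ≡) = inj₂ (y ∷ F′ , y∷F′⊆y∷F , AllP.anti-mono F′⊆F y∉F AllPairs.∷ uF′ ,
          ℕP.≤∧≢⇒< (ℕP.≤-pred y<1+B) y≢B All.∷ F′<B , trans (cong (g y ⊕_) Σ≡) (⊕-swap (g y) (g B) (Σϕ g F′)))
  where
  y∷F′⊆y∷F : y ∷ F′ ⊆ y ∷ F
  y∷F′⊆y∷F (here y≡) = here y≡
  y∷F′⊆y∷F (there z∈F′) = there (F′⊆F z∈F′)

Σϕ-≤-Σϕ< : ∀ {g} → (∀ i → 𝟘 ≤ g i) → ∀ B F → Unique F → All (ℕ._< B) F → Σϕ g F ≤ Σϕ< g B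
Σϕ-≤-Σϕ< g≥0 zero [] _ _ = ≤-refl
Σϕ-≤-Σϕ< g≥0 zero (_ ∷ _) _ (() All.∷ _)
Σϕ-≤-Σϕ< g≥0 (suc B) F uF F<1+B with remove-top _ B F uF F<1+B
... | inj₁ F<B = ≤-trans (Σϕ-≤-Σϕ< g≥0 B F uF F<B) (x≤x⊕y (g≥0 B))
... | inj₂ (F′ , _ , uF′ , F′<B , Σ≡) = subst₂ _≤_ (sym Σ≡) (⊕-comm _ _) (⊕-monoʳ-≤ _ (Σϕ-≤-Σϕ< g≥0 B F′ uF′ F′<B))

upper-bound : ∀ F → ∃[ B ] All (ℕ._< B) F
upper-bound [] = 0 , All.[]
upper-bound (y ∷ F) with upper-bound F
... | B , F<B = suc y ℕ.+ B , ℕP.m≤m+n (suc y) B All.∷ All.map (λ z<B → ℕP.<-≤-trans z<B (ℕP.m≤n+m B (suc y))) F<B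

sparse : ℕ → ℕ → ℤ[ϕ]
sparse m i = ϕ⁻^ suc (m ℕ.+ (i ℕ.+ i))

sparseCoeff : ℕ → ℕ → ℕ
sparseCoeff m i = fibNum (suc (m ℕ.+ (i ℕ.+ i)))

ϕ⁻^-telescope : ∀ m B → Σϕ< (sparse m) B ⊕ ϕ⁻^ (m ℕ.+ (B ℕ.+ B)) ≡ ϕ⁻^ m
ϕ⁻^-telescope m zero = trans (⊕-identityˡ _) (cong ϕ⁻^_ (ℕP.+-identityʳ m))
ϕ⁻^-telescope m (suc B) = begin
  (S ⊕ ϕ⁻^ suc n) ⊕ ϕ⁻^ (m ℕ.+ (suc B ℕ.+ suc B))   ≡⟨ cong (λ k → (S ⊕ ϕ⁻^ suc n) ⊕ ϕ⁻^ k) (e m B) ⟩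
  (S ⊕ ϕ⁻^ suc n) ⊕ ϕ⁻^ suc (suc n)                 ≡⟨ ⊕-assoc S _ _ ⟩
  S ⊕ (ϕ⁻^ suc n ⊕ ϕ⁻^ suc (suc n))                 ≡⟨ cong (S ⊕_) (ϕ⁻^-split n) ⟨
  S ⊕ ϕ⁻^ n                                         ≡⟨ ϕ⁻^-telescope m B ⟩
  ϕ⁻^ m                                             ∎
  where
  open ≡-Reasoning
  S = Σϕ< (sparse m) B
  n = m ℕ.+ (B ℕ.+ B)
  e : ∀ m B → m ℕ.+ (suc B ℕ.+ suc B) ≡ suc (suc (m ℕ.+ (B ℕ.+ B)))
  e = ℕS.solve-∀

sparse-sum-< : ∀ m F → Unique F → Σϕ (sparse m) F < ϕ⁻^ m
sparse-sum-< m F uF with upper-bound F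
... | B , F<B = begin-strict
  Σϕ (sparse m) F                   ≤⟨ Σϕ-≤-Σϕ< (λ i → <⇒≤ (ϕ⁻^-positive (suc (m ℕ.+ (i ℕ.+ i))))) B F uF F<B ⟩
  Σϕ< (sparse m) B                  <⟨ x<x⊕y (ϕ⁻^-positive (m ℕ.+ (B ℕ.+ B))) ⟩
  Σϕ< (sparse m) B ⊕ ϕ⁻^ (m ℕ.+ (B ℕ.+ B))   ≡⟨ ϕ⁻^-telescope m B ⟩
  ϕ⁻^ m                             ∎
  where open ≤-Reasoning

c₁-sparse : ∀ m i → c₁ (sparse m i) ≡ signed m (sparseCoeff m i)
c₁-sparse m i = trans (cong c₁ (ϕ⁻^-coeffs (suc (m ℕ.+ (i ℕ.+ i)))))
  (trans (signed-2+ (m ℕ.+ (i ℕ.+ i)) _) (signed-even m i _))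

sparseCoeff-increasing : ∀ m i → sparseCoeff m i ℕ.< sparseCoeff m (suc i)
sparseCoeff-increasing m i = subst (λ n → sparseCoeff m i ℕ.< fibNum (suc n)) (sym (e m i)) (fibNum-<₂ (m ℕ.+ (i ℕ.+ i)))
  where
  e : ∀ m i → m ℕ.+ (suc i ℕ.+ suc i) ≡ suc (suc (m ℕ.+ (i ℕ.+ i)))
  e = ℕS.solve-∀

sparse-sum : ∀ m F → F ≢ [] → Unique F →
             𝟘 < Σϕ (sparse m) F × Σϕ (sparse m) F < ϕ⁻^ m ×
             c₁ (Σϕ (sparse m) F) ≡ signed m (sum (map (sparseCoeff m) F))
sparse-sum m F F≢[] uF = Σϕ-positive (λ i → ϕ⁻^-positive (suc (m ℕ.+ (i ℕ.+ i)))) F F≢[] ,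
  sparse-sum-< m F uF , c₁-Σϕ m (sparseCoeff m) (c₁-sparse m) F

gword-suc : ∀ d → gword (suc d) ≡ 1 ℕ.∸ carry (fracβ (suc d))
gword-suc = fib≡sturmian

Occ-gword-∷ : ∀ {a v d} → gword d ≡ a → Occ fib v d → Occ gword (a ∷ v) d
Occ-gword-∷ {v = v} {d} gd≡a occ = gd≡a , Occ-gword v d occ

gword-1-IP : ∀ k → IPSet (Occ gword (1 ∷ prefix fib k))
gword-1-IP k with prefix-occurs-near-0 k
... | δ , 0<δ , δ≤ϕ⁻² , occurs with ϕ⁻^-below 0<δ
... | K , ϕ⁻ᴷ<δ = sparseCoeff m , sparseCoeff-increasing m , occurrence
  where
  m = K ℕ.+ K
  occurrence : ∀ F → F ≢ [] → Unique F → Occ gword (1 ∷ prefix fib k) (sum (map (sparseCoeff m) F))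
  occurrence F F≢[] uF with sparse-sum m F F≢[] uF
  ... | 0<G , G<ϕ⁻ᵐ , c₁G = occ (sum (map (sparseCoeff m) F)) frac≡
    where
    G = Σϕ (sparse m) F
    G<δ : G < δ
    G<δ = <-trans G<ϕ⁻ᵐ (≤-<-trans (ϕ⁻^-antitone K K) ϕ⁻ᴷ<δ)
    frac≡ : fracβ (sum (map (sparseCoeff m) F)) ≡ G
    frac≡ = InUnit-unique (fracβ-inUnit _) (<⇒≤ 0<G , <-trans G<δ (≤-<-trans δ≤ϕ⁻² ϕ⁻²<1))
      (sym (trans c₁G (signed-even 0 K _)))
    occ : ∀ d → fracβ d ≡ G → Occ gword (1 ∷ prefix fib k) d
    occ zero 𝟘≡G = ⊥-elim (<-irrefl (subst (𝟘 <_) (sym 𝟘≡G) 0<G))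
    occ (suc d) frac≡G = Occ-gword-∷ (trans (gword-suc d) (cong (1 ℕ.∸_) (carry-< G<ϕ⁻²)))
                           (occurs (suc d) (inj₁ (subst (_< δ) (sym frac≡G) G<δ)))
      where
      G<ϕ⁻² : fracβ (suc d) < ϕ⁻^ 2
      G<ϕ⁻² = subst (_< ϕ⁻^ 2) (sym frac≡G) (<-≤-trans G<δ δ≤ϕ⁻²)

gword-0-IP : ∀ k → IPSet (Occ gword (0 ∷ prefix fib k))
gword-0-IP k with prefix-occurs-near-0 k
... | δ , 0<δ , δ≤ϕ⁻² , occurs with ϕ⁻^-below 0<δ
... | K , ϕ⁻ᴷ<δ = sparseCoeff m , sparseCoeff-increasing m , occurrence
  where
  m = suc (K ℕ.+ K)
  occurrence : ∀ F → F ≢ [] → Unique F → Occ gword (0 ∷ prefix fib k) (sum (map (sparseCoeff m) F))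
  occurrence F F≢[] uF with sparse-sum m F F≢[] uF
  ... | 0<G , G<ϕ⁻ᵐ , c₁G = occ (sum (map (sparseCoeff m) F)) frac≡
    where
    G = Σϕ (sparse m) F
    G<δ : G < δ
    G<δ = <-trans G<ϕ⁻ᵐ (<-trans (ϕ⁻^-decreasing (K ℕ.+ K)) (≤-<-trans (ϕ⁻^-antitone K K) ϕ⁻ᴷ<δ))
    frac≡ : fracβ (sum (map (sparseCoeff m) F)) ≡ 𝟙 ⊝ G
    frac≡ = InUnit-unique (fracβ-inUnit _) (<⇒≤ (<⇒0<⊝ (<-trans G<δ (≤-<-trans δ≤ϕ⁻² ϕ⁻²<1))) , x⊝y<x 0<G)
      (sym (trans (c₁-𝟙⊝ G) (trans (cong ℤ.-_ c₁G) (trans (ℤP.neg-involutive _) (signed-even 0 K _)))))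
    near : Near δ (𝟙 ⊝ G)
    near = inj₂ (<-respᵈ (e G δ) G<δ)
      where
      e : ∀ x δ → δ ⊝ x ≡ ((𝟙 ⊝ x) ⊕ δ) ⊝ 𝟙
      e (mk a b) (mk c d) = cong₂ mk (solve (a ∷ c ∷ [])) (solve (b ∷ d ∷ []))
    occ : ∀ d → fracβ d ≡ 𝟙 ⊝ G → Occ gword (0 ∷ prefix fib k) d
    occ zero frac≡ = Occ-gword-∷ refl (occurs zero (subst (Near δ) (sym frac≡) near))
    occ (suc d) frac≡ = Occ-gword-∷ (trans (gword-suc d) (cong (1 ℕ.∸_) (carry-≥ ϕ⁻²≤)))
                          (occurs (suc d) (subst (Near δ) (sym frac≡) near))
      where
      ϕ⁻²≤ : ϕ⁻^ 2 ≤ fracβ (suc d)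
      ϕ⁻²≤ = subst (ϕ⁻^ 2 ≤_) (sym frac≡)
        (<⇒≤ (⊝-monoʳ-< 𝟙 (<-≤-trans G<δ (≤-trans δ≤ϕ⁻² (<⇒≤ (ϕ⁻^-decreasing 1))))))

proposition4p1 : ((k : ℕ) → IPStarSet (Occ fib (prefix fib k)))
    × ((k : ℕ) → IPSet (Occ gword (0 ∷ prefix fib k)) × IPSet (Occ gword (1 ∷ prefix fib k)))
proposition4p1 = prefix-IP* , λ k → gword-0-IP k , gword-1-IP k
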